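{- For integers $n\ge0$ and $j\ge1$, and for each choice of signs (upper signs together or lower signs together), \[ \sum_{k=0}^n\binom{n}{k}2^kF_{jk}(\pm\sqrt5F_j)^{n-k}B_{n-k}=nF_j\Big(L_j^{n-1}+(\mp\sqrt5F_j+L_j)^{n-1}\Big). \]
   Context: $F_n$ and $L_n$ denote the Fibonacci and Lucas numbers: $F_0=0,F_1=1$, $L_0=2,L_1=1$, and $u_n=u_{n-1}+u_{n-2}$. The Bernoulli numbers $B_n$ are defined by $\sum_{n\ge0}B_n\frac{z^n}{n!}=\frac{z}{e^z-1}$. For $n=0$ the right-hand side is $0$. -}

module Defs where

open import Data.Nat using (ℕ; zero; suc; _∸_)
import Data.Nat as ℕ
open import Data.Nat.Combinatorics using (_C_)
open import Data.Integer using (+_)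
open import Data.Rational using (ℚ; 0ℚ; 1ℚ; _/_; -_; _+_; _*_)
open import Data.List using (List; []; _∷_; _++_; [_]; zipWith; upTo; foldr; length)
open import Data.Sign using (Sign)

fib : ℕ → ℕ
fib zero = 0
fib (suc zero) = 1
fib (suc (suc n)) = fib (suc n) ℕ.+ fib n

luc : ℕ → ℕ
luc zero = 2
luc (suc zero) = 1
luc (suc (suc n)) = luc (suc n) ℕ.+ luc n

ℕ→ℚ : ℕ → ℚ
ℕ→ℚ n = + n / 1

sumℚ : List ℚ → ℚ
sumℚ = foldr _+_ 0ℚ

-- Bernoulli numbers (convention B₁ = -1/2, i.e. z/(e^z - 1)), via the
-- equivalent standard recurrence: B₀ = 1, Σ_{k=0}^{m} C(m+1,k) B_k = 0 (m ≥ 1).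
-- bernList m = [B₀, …, B_{m-1}]
nextBern : ℕ → List ℚ → ℚ
nextBern zero _ = 1ℚ
nextBern (suc m') bs =
  - ((+ 1 / suc (suc m')) *
     sumℚ (zipWith (λ k b → ℕ→ℚ (suc (suc m') C k) * b) (upTo (suc m')) bs))

bernList : ℕ → List ℚ
bernList zero = []
bernList (suc m) = bernList m ++ [ nextBern m (bernList m) ]

bernoulli : ℕ → ℚ
bernoulli m = nextBern m (bernList m)

record ℚ√5 : Set where
  constructor _+√5·_
  field
    re : ℚ
    im : ℚ

infixl 6 _⊕_
infixl 7 _⊗_

_⊕_ : ℚ√5 → ℚ√5 → ℚ√5
(a +√5· b) ⊕ (c +√5· d) = (a + c) +√5· (b + d)

_⊗_ : ℚ√5 → ℚ√5 → ℚ√5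
(a +√5· b) ⊗ (c +√5· d) = (a * c + ℕ→ℚ 5 * (b * d)) +√5· (a * d + b * c)

emb : ℚ → ℚ√5
emb q = q +√5· 0ℚ

√5 : ℚ√5
√5 = 0ℚ +√5· 1ℚ

_^′_ : ℚ√5 → ℕ → ℚ√5
x ^′ zero = emb 1ℚ
x ^′ suc n = x ⊗ (x ^′ n)

Σ≤ : ℕ → (ℕ → ℚ√5) → ℚ√5
Σ≤ zero f = f 0
Σ≤ (suc n) f = Σ≤ n f ⊕ f (suc n)

signℚ : Sign → ℚ
signℚ Sign.+ = 1ℚ
signℚ Sign.- = - 1ℚ

-- LHS and RHS of the identity; s = Sign.+ is the upper-sign choice
lhs : Sign → ℕ → ℕ → ℚ√5
lhs s n j = Σ≤ n (λ k →
  emb (ℕ→ℚ (n C k) * ℕ→ℚ (2 ℕ.^ k) * ℕ→ℚ (fib (j ℕ.* k)))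
  ⊗ ((emb (signℚ s) ⊗ √5 ⊗ emb (ℕ→ℚ (fib j))) ^′ (n ∸ k))
  ⊗ emb (bernoulli (n ∸ k)))

-- for n = 0 the factor n makes the RHS 0 (exponent n-1 truncated, irrelevant)
rhs : Sign → ℕ → ℕ → ℚ√5
rhs s n j = emb (ℕ→ℚ n * ℕ→ℚ (fib j)) ⊗
  ((emb (ℕ→ℚ (luc j)) ^′ (n ∸ 1)) ⊕
   ((emb (- signℚ s) ⊗ √5 ⊗ emb (ℕ→ℚ (fib j)) ⊕ emb (ℕ→ℚ (luc j))) ^′ (n ∸ 1)))

-- Write ε for the sign, X = ε√5 F_j and L = L_j, and compute in ℚ(√5) after multiplying
-- by ε√5. Binet's formula gives ε√5 2ᵏ F_{jk} = (L + X)ᵏ − (L − X)ᵏ, so ε√5 times the left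
-- side is T(L + X) − T(L − X), where T(a) = Σₖ C(n,k) aᵏ X^{n−k} B_{n−k} = Xⁿ Bₙ(a/X) is a
-- homogenised Bernoulli polynomial. The two points differ by 2X, and two applications of
-- Bₙ(t + 1) − Bₙ(t) = n tⁿ⁻¹ give nX((L − X)ⁿ⁻¹ + Lⁿ⁻¹), which is ε√5 times the right side.

module Submission where

open import Defs
open import Data.Nat using (ℕ; zero; suc; _∸_; _≤_; _≥_)
import Data.Nat as ℕ
import Data.Nat.Properties as ℕₚ
open import Data.Nat.Combinatorics
  using (_C_; nCk+nC[k+1]≡[n+1]C[k+1]; k>n⇒nCk≡0; nCk≡nC[n∸k]; nCn≡1; nC1≡n)
open import Data.Nat.Coprimality using (1-coprimeTo) renaming (sym to coprime-sym)
open import Data.Integer using (+_)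
import Data.Integer as ℤ
import Data.Integer.Properties as ℤ
open import Data.Rational using (mkℚ; 0ℚ; 1ℚ; _/_; -_; _+_; _*_; 1/_; toℚᵘ)
import Data.Rational.Properties as ℚ
import Data.Rational.Unnormalised as ℚᵘ
import Data.Rational.Unnormalised.Properties as ℚᵘ
open import Data.List using (applyUpTo; upTo; zipWith; _∷_; [_]; _++_)
open import Data.List.Properties using (applyUpTo-∷ʳ)
open import Data.Maybe using (Maybe; just; nothing)
open import Data.Product using (_,_)
open import Data.Sign using (Sign)
open import Relation.Nullary using (yes)
open import Relation.Nullary.Decidable using (dec⇒maybe)
open import Relation.Binary.PropositionalEquality hiding ([_])
open import Algebra.Bundles using (CommutativeRing)
open import Algebra.Definitions {A = ℚ√5} _≡_
  using (Associative; Commutative; LeftIdentity; LeftInverse; _DistributesOverˡ_)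
open import Algebra.Structures {A = ℚ√5} _≡_ using (IsCommutativeRing)
open import Algebra.Consequences.Propositional
  using (comm∧idˡ⇒id; comm∧invˡ⇒inv; comm∧distrˡ⇒distrʳ)
open import Tactic.RingSolver using (solve-∀)
open import Tactic.RingSolver.Core.AlmostCommutativeRing
  using (AlmostCommutativeRing; fromCommutativeRing)

ℕ→ℚ≡mkℚ : ∀ n → ℕ→ℚ n ≡ mkℚ (+ n) 0 (coprime-sym (1-coprimeTo n))
ℕ→ℚ≡mkℚ n = ℚ.normalize-coprime (coprime-sym (1-coprimeTo n))

toℚᵘ-ℕ→ℚ : ∀ n → toℚᵘ (ℕ→ℚ n) ≡ ℚᵘ.mkℚᵘ (+ n) 0
toℚᵘ-ℕ→ℚ n = cong toℚᵘ (ℕ→ℚ≡mkℚ n)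

ℕ→ℚ-homo-+ : ∀ m n → ℕ→ℚ (m ℕ.+ n) ≡ ℕ→ℚ m + ℕ→ℚ n
ℕ→ℚ-homo-+ m n = ℚ.toℚᵘ-injective (begin
  toℚᵘ (ℕ→ℚ (m ℕ.+ n))                   ≡⟨ toℚᵘ-ℕ→ℚ (m ℕ.+ n) ⟩
  ℚᵘ.mkℚᵘ (+ (m ℕ.+ n)) 0                ≈⟨ ℚᵘ.*≡* (cong (ℤ._* + 1) numerator) ⟩
  ℚᵘ.mkℚᵘ (+ m) 0 ℚᵘ.+ ℚᵘ.mkℚᵘ (+ n) 0    ≡⟨ cong₂ ℚᵘ._+_ (toℚᵘ-ℕ→ℚ m) (toℚᵘ-ℕ→ℚ n) ⟨
  toℚᵘ (ℕ→ℚ m) ℚᵘ.+ toℚᵘ (ℕ→ℚ n)         ≈⟨ ℚ.toℚᵘ-homo-+ (ℕ→ℚ m) (ℕ→ℚ n) ⟨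
  toℚᵘ (ℕ→ℚ m + ℕ→ℚ n)                   ∎)
  where
  open ℚᵘ.≃-Reasoning
  numerator : + (m ℕ.+ n) ≡ + m ℤ.* + 1 ℤ.+ + n ℤ.* + 1
  numerator = trans (ℤ.pos-+ m n) (sym (cong₂ ℤ._+_ (ℤ.*-identityʳ (+ m)) (ℤ.*-identityʳ (+ n))))

ℕ→ℚ-homo-* : ∀ m n → ℕ→ℚ (m ℕ.* n) ≡ ℕ→ℚ m * ℕ→ℚ n
ℕ→ℚ-homo-* m n = ℚ.toℚᵘ-injective (begin
  toℚᵘ (ℕ→ℚ (m ℕ.* n))                   ≡⟨ toℚᵘ-ℕ→ℚ (m ℕ.* n) ⟩
  ℚᵘ.mkℚᵘ (+ (m ℕ.* n)) 0                ≈⟨ ℚᵘ.*≡* (cong (ℤ._* + 1) (ℤ.pos-* m n)) ⟩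
  ℚᵘ.mkℚᵘ (+ m) 0 ℚᵘ.* ℚᵘ.mkℚᵘ (+ n) 0    ≡⟨ cong₂ ℚᵘ._*_ (toℚᵘ-ℕ→ℚ m) (toℚᵘ-ℕ→ℚ n) ⟨
  toℚᵘ (ℕ→ℚ m) ℚᵘ.* toℚᵘ (ℕ→ℚ n)         ≈⟨ ℚ.toℚᵘ-homo-* (ℕ→ℚ m) (ℕ→ℚ n) ⟨
  toℚᵘ (ℕ→ℚ m * ℕ→ℚ n)                   ∎)
  where open ℚᵘ.≃-Reasoning

ℕ→ℚ-*-inverse : ∀ m → ℕ→ℚ (suc m) * (+ 1 / suc m) ≡ 1ℚ
ℕ→ℚ-*-inverse m = begin
  ℕ→ℚ (suc m) * (+ 1 / suc m)  ≡⟨ cong₂ _*_ (ℕ→ℚ≡mkℚ (suc m)) (ℚ.normalize-coprime (1-coprimeTo (suc m))) ⟩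
  p * 1/ p                     ≡⟨ ℚ.*-inverseʳ p ⟩
  1ℚ                           ∎
  where
  open ≡-Reasoning
  p = mkℚ (+ suc m) 0 (coprime-sym (1-coprimeTo (suc m)))

ℚ-ring : AlmostCommutativeRing _ _
ℚ-ring = fromCommutativeRing ℚ.+-*-commutativeRing (λ x → dec⇒maybe (0ℚ ℚ.≟ x))

0ℚ√5 1ℚ√5 : ℚ√5
0ℚ√5 = emb 0ℚ
1ℚ√5 = emb 1ℚ

neg : ℚ√5 → ℚ√5
neg (a +√5· b) = (- a) +√5· (- b)

infix 4 _≡√5_
_≡√5_ : ∀ {a b c d} → a ≡ c → b ≡ d → a +√5· b ≡ c +√5· d
_≡√5_ = cong₂ _+√5·_

⊕-assoc : Associative _⊕_
⊕-assoc (a +√5· b) (c +√5· d) (e +√5· f) = ℚ.+-assoc a c e ≡√5 ℚ.+-assoc b d f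

⊕-comm : Commutative _⊕_
⊕-comm (a +√5· b) (c +√5· d) = ℚ.+-comm a c ≡√5 ℚ.+-comm b d

⊕-identityˡ : LeftIdentity 0ℚ√5 _⊕_
⊕-identityˡ (a +√5· b) = ℚ.+-identityˡ a ≡√5 ℚ.+-identityˡ b

neg-inverseˡ : LeftInverse 0ℚ√5 neg _⊕_
neg-inverseˡ (a +√5· b) = ℚ.+-inverseˡ a ≡√5 ℚ.+-inverseˡ b

-- In the component identities t stands for 5 = √5².
⊗-comm : Commutative _⊗_
⊗-comm (a +√5· b) (c +√5· d) = re a b c d (ℕ→ℚ 5) ≡√5 im a b c d
  where
  re : ∀ a b c d t → a * c + t * (b * d) ≡ c * a + t * (d * b)
  re = solve-∀ ℚ-ring
  im : ∀ a b c d → a * d + b * c ≡ c * b + d * a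
  im = solve-∀ ℚ-ring

⊗-assoc : Associative _⊗_
⊗-assoc (a +√5· b) (c +√5· d) (e +√5· f) = re a b c d e f (ℕ→ℚ 5) ≡√5 im a b c d e f (ℕ→ℚ 5)
  where
  re : ∀ a b c d e f t → (a * c + t * (b * d)) * e + t * ((a * d + b * c) * f)
                      ≡ a * (c * e + t * (d * f)) + t * (b * (c * f + d * e))
  re = solve-∀ ℚ-ring
  im : ∀ a b c d e f t → (a * c + t * (b * d)) * f + (a * d + b * c) * e
                      ≡ a * (c * f + d * e) + b * (c * e + t * (d * f))
  im = solve-∀ ℚ-ring

⊗-identityˡ : LeftIdentity 1ℚ√5 _⊗_
⊗-identityˡ (a +√5· b) = re a b (ℕ→ℚ 5) ≡√5 im a b
  where
  re : ∀ a b t → 1ℚ * a + t * (0ℚ * b) ≡ a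
  re = solve-∀ ℚ-ring
  im : ∀ a b → 1ℚ * b + 0ℚ * a ≡ b
  im = solve-∀ ℚ-ring

⊗-distribˡ-⊕ : _⊗_ DistributesOverˡ _⊕_
⊗-distribˡ-⊕ (a +√5· b) (c +√5· d) (e +√5· f) = re a b c d e f (ℕ→ℚ 5) ≡√5 im a b c d e f
  where
  re : ∀ a b c d e f t → a * (c + e) + t * (b * (d + f)) ≡ (a * c + t * (b * d)) + (a * e + t * (b * f))
  re = solve-∀ ℚ-ring
  im : ∀ a b c d e f → a * (d + f) + b * (c + e) ≡ (a * d + b * c) + (a * f + b * e)
  im = solve-∀ ℚ-ring

ℚ√5-isCommutativeRing : IsCommutativeRing _⊕_ _⊗_ neg 0ℚ√5 1ℚ√5
ℚ√5-isCommutativeRing = record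
  { isRing = record
    { +-isAbelianGroup = record
      { isGroup = record
        { isMonoid = record
          { isSemigroup = record
            { isMagma = record { isEquivalence = isEquivalence ; ∙-cong = cong₂ _⊕_ }
            ; assoc = ⊕-assoc
            }
          ; identity = comm∧idˡ⇒id ⊕-comm ⊕-identityˡ
          }
        ; inverse = comm∧invˡ⇒inv ⊕-comm neg-inverseˡ
        ; ⁻¹-cong = cong neg
        }
      ; comm = ⊕-comm
      }
    ; *-cong = cong₂ _⊗_
    ; *-assoc = ⊗-assoc
    ; *-identity = comm∧idˡ⇒id ⊗-comm ⊗-identityˡ
    ; distrib = ⊗-distribˡ-⊕ , comm∧distrˡ⇒distrʳ ⊗-comm ⊗-distribˡ-⊕
    }
  ; *-comm = ⊗-comm
  }

ℚ√5-commutativeRing : CommutativeRing _ _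
ℚ√5-commutativeRing = record { isCommutativeRing = ℚ√5-isCommutativeRing }

-- The solver needs a syntactic zero test to discard vanishing coefficients.
ℚ√5-ring : AlmostCommutativeRing _ _
ℚ√5-ring = fromCommutativeRing ℚ√5-commutativeRing isZero
  where
  isZero : (x : ℚ√5) → Maybe (0ℚ√5 ≡ x)
  isZero (a +√5· b) with 0ℚ ℚ.≟ a | 0ℚ ℚ.≟ b
  ... | yes a≡0 | yes b≡0 = just (a≡0 ≡√5 b≡0)
  ... | _       | _       = nothing

open import Algebra.Properties.CommutativeSemiring.Exp
  (CommutativeRing.commutativeSemiring ℚ√5-commutativeRing)
  using (_^_; ^-homo-*; ^-assocʳ; ^-distrib-*)

fromℕ : ℕ → ℚ√5
fromℕ n = emb (ℕ→ℚ n)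

emb-homo-+ : ∀ p q → emb (p + q) ≡ emb p ⊕ emb q
emb-homo-+ p q = refl ≡√5 sym (ℚ.+-identityˡ 0ℚ)

emb-homo-* : ∀ p q → emb (p * q) ≡ emb p ⊗ emb q
emb-homo-* p q = re p q (ℕ→ℚ 5) ≡√5 im p q
  where
  re : ∀ p q t → p * q ≡ p * q + t * (0ℚ * 0ℚ)
  re = solve-∀ ℚ-ring
  im : ∀ p q → 0ℚ ≡ p * 0ℚ + 0ℚ * q
  im = solve-∀ ℚ-ring

fromℕ-homo-+ : ∀ m n → fromℕ (m ℕ.+ n) ≡ fromℕ m ⊕ fromℕ n
fromℕ-homo-+ m n = trans (cong emb (ℕ→ℚ-homo-+ m n)) (emb-homo-+ (ℕ→ℚ m) (ℕ→ℚ n))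

fromℕ-homo-* : ∀ m n → fromℕ (m ℕ.* n) ≡ fromℕ m ⊗ fromℕ n
fromℕ-homo-* m n = trans (cong emb (ℕ→ℚ-homo-* m n)) (emb-homo-* (ℕ→ℚ m) (ℕ→ℚ n))

^′≡^ : ∀ x n → x ^′ n ≡ x ^ n
^′≡^ x zero    = refl
^′≡^ x (suc n) = cong (x ⊗_) (^′≡^ x n)

^′-homo-⊗ : ∀ x m n → x ^′ (m ℕ.+ n) ≡ x ^′ m ⊗ x ^′ n
^′-homo-⊗ x m n rewrite ^′≡^ x (m ℕ.+ n) | ^′≡^ x m | ^′≡^ x n = ^-homo-* x m n

^′-assocʳ : ∀ x m n → (x ^′ m) ^′ n ≡ x ^′ (m ℕ.* n)
^′-assocʳ x m n rewrite ^′≡^ (x ^′ m) n | ^′≡^ x m | ^′≡^ x (m ℕ.* n) = ^-assocʳ x m n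

^′-distrib-⊗ : ∀ x y n → (x ⊗ y) ^′ n ≡ x ^′ n ⊗ y ^′ n
^′-distrib-⊗ x y n rewrite ^′≡^ (x ⊗ y) n | ^′≡^ x n | ^′≡^ y n = ^-distrib-* x y n

fromℕ-homo-^ : ∀ m n → fromℕ (m ℕ.^ n) ≡ fromℕ m ^′ n
fromℕ-homo-^ m zero    = refl
fromℕ-homo-^ m (suc n) = trans (fromℕ-homo-* m (m ℕ.^ n)) (cong (fromℕ m ⊗_) (fromℕ-homo-^ m n))

⊗-cancelˡ : ∀ h c {u v} → h ⊗ c ≡ 1ℚ√5 → c ⊗ u ≡ c ⊗ v → u ≡ v
⊗-cancelˡ h c {u} {v} hc≡1 cu≡cv = begin
  u                ≡⟨ ⊗-identityˡ u ⟨
  1ℚ√5 ⊗ u         ≡⟨ cong (_⊗ u) hc≡1 ⟨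
  (h ⊗ c) ⊗ u      ≡⟨ ⊗-assoc h c u ⟩
  h ⊗ (c ⊗ u)      ≡⟨ cong (h ⊗_) cu≡cv ⟩
  h ⊗ (c ⊗ v)      ≡⟨ ⊗-assoc h c v ⟨
  (h ⊗ c) ⊗ v      ≡⟨ cong (_⊗ v) hc≡1 ⟩
  1ℚ√5 ⊗ v         ≡⟨ ⊗-identityˡ v ⟩
  v                ∎
  where open ≡-Reasoning

Σ≤-cong : ∀ n {f g} → (∀ k → k ≤ n → f k ≡ g k) → Σ≤ n f ≡ Σ≤ n g
Σ≤-cong zero    f≗g = f≗g 0 ℕ.z≤n
Σ≤-cong (suc n) f≗g =
  cong₂ _⊕_ (Σ≤-cong n (λ k k≤n → f≗g k (ℕₚ.m≤n⇒m≤1+n k≤n))) (f≗g (suc n) ℕₚ.≤-refl)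

Σ≤-suc : ∀ n f → Σ≤ (suc n) f ≡ f 0 ⊕ Σ≤ n (λ k → f (suc k))
Σ≤-suc zero    f = refl
Σ≤-suc (suc n) f =
  trans (cong (_⊕ f (2 ℕ.+ n)) (Σ≤-suc n f)) (⊕-assoc (f 0) (Σ≤ n (λ k → f (suc k))) (f (2 ℕ.+ n)))

Σ≤-⊕ : ∀ n f g → Σ≤ n (λ k → f k ⊕ g k) ≡ Σ≤ n f ⊕ Σ≤ n g
Σ≤-⊕ zero    f g = refl
Σ≤-⊕ (suc n) f g =
  trans (cong (_⊕ (f (suc n) ⊕ g (suc n))) (Σ≤-⊕ n f g)) (interchange (Σ≤ n f) (Σ≤ n g) (f (suc n)) (g (suc n)))
  where
  interchange : ∀ a b c d → (a ⊕ b) ⊕ (c ⊕ d) ≡ (a ⊕ c) ⊕ (b ⊕ d)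
  interchange = solve-∀ ℚ√5-ring

Σ≤-neg : ∀ n f → Σ≤ n (λ k → neg (f k)) ≡ neg (Σ≤ n f)
Σ≤-neg zero    f = refl
Σ≤-neg (suc n) f = trans (cong (_⊕ neg (f (suc n))) (Σ≤-neg n f)) (neg-distrib (Σ≤ n f) (f (suc n)))
  where
  neg-distrib : ∀ a b → neg a ⊕ neg b ≡ neg (a ⊕ b)
  neg-distrib = solve-∀ ℚ√5-ring

Σ≤-distribˡ : ∀ n c f → c ⊗ Σ≤ n f ≡ Σ≤ n (λ k → c ⊗ f k)
Σ≤-distribˡ zero    c f = refl
Σ≤-distribˡ (suc n) c f =
  trans (⊗-distribˡ-⊕ c (Σ≤ n f) (f (suc n))) (cong (_⊕ c ⊗ f (suc n)) (Σ≤-distribˡ n c f))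

Σ≤-zero : ∀ n → Σ≤ n (λ _ → 0ℚ√5) ≡ 0ℚ√5
Σ≤-zero zero    = refl
Σ≤-zero (suc n) = trans (cong (_⊕ 0ℚ√5) (Σ≤-zero n)) (⊕-identityˡ 0ℚ√5)

Σ≤-reverse : ∀ n f → Σ≤ n (λ k → f (n ∸ k)) ≡ Σ≤ n f
Σ≤-reverse zero    f = refl
Σ≤-reverse (suc n) f = begin
  Σ≤ (suc n) (λ k → f (suc n ∸ k))  ≡⟨ Σ≤-suc n (λ k → f (suc n ∸ k)) ⟩
  f (suc n) ⊕ Σ≤ n (λ k → f (n ∸ k)) ≡⟨ cong (f (suc n) ⊕_) (Σ≤-reverse n f) ⟩
  f (suc n) ⊕ Σ≤ n f                 ≡⟨ ⊕-comm (f (suc n)) (Σ≤ n f) ⟩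
  Σ≤ (suc n) f                       ∎
  where open ≡-Reasoning

-- For y m = xᵐ Bₘ, translate y a n is the homogenised Bernoulli polynomial xⁿ Bₙ(a/x).
translate : (ℕ → ℚ√5) → ℚ√5 → ℕ → ℚ√5
translate y a n = Σ≤ n (λ k → fromℕ (n C k) ⊗ a ^′ k ⊗ y (n ∸ k))

translate-cong : ∀ n {y z} a → (∀ m → y m ≡ z m) → translate y a n ≡ translate z a n
translate-cong n a y≗z = Σ≤-cong n (λ k _ → cong (fromℕ (n C k) ⊗ a ^′ k ⊗_) (y≗z (n ∸ k)))

-- The extra top term vanishes because C(n, n + 1) = 0.
translate-∘suc : ∀ (y : ℕ → ℚ√5) a n →
  Σ≤ (suc n) (λ k → fromℕ (n C k) ⊗ a ^′ k ⊗ y (suc n ∸ k)) ≡ translate (λ m → y (suc m)) a n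
translate-∘suc y a n = begin
  Σ≤ n g ⊕ g (suc n)     ≡⟨ cong (Σ≤ n g ⊕_) g-last ⟩
  Σ≤ n g ⊕ 0ℚ√5          ≡⟨ ⊕-identityʳ (Σ≤ n g) ⟩
  Σ≤ n g                 ≡⟨ Σ≤-cong n g≡ ⟩
  translate (λ m → y (suc m)) a n ∎
  where
  open ≡-Reasoning
  g : ℕ → ℚ√5
  g k = fromℕ (n C k) ⊗ a ^′ k ⊗ y (suc n ∸ k)
  annihilate : ∀ b e → 0ℚ√5 ⊗ b ⊗ e ≡ 0ℚ√5
  annihilate = solve-∀ ℚ√5-ring
  ⊕-identityʳ : ∀ p → p ⊕ 0ℚ√5 ≡ p
  ⊕-identityʳ = solve-∀ ℚ√5-ring
  g-last : g (suc n) ≡ 0ℚ√5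
  g-last = trans (cong (λ c → fromℕ c ⊗ a ^′ suc n ⊗ y (n ∸ n)) (k>n⇒nCk≡0 (ℕₚ.n<1+n n)))
                 (annihilate (a ^′ suc n) (y (n ∸ n)))
  g≡ : ∀ k → k ≤ n → g k ≡ fromℕ (n C k) ⊗ a ^′ k ⊗ y (suc (n ∸ k))
  g≡ k k≤n = cong (λ m → fromℕ (n C k) ⊗ a ^′ k ⊗ y m) (ℕₚ.+-∸-assoc 1 k≤n)

translate-suc : ∀ y a n → translate y a (suc n) ≡ translate (λ m → y (suc m)) a n ⊕ a ⊗ translate y a n
translate-suc y a n = begin
  translate y a (suc n)                       ≡⟨ Σ≤-suc n f ⟩
  f 0 ⊕ Σ≤ n (λ k → f (suc k))                ≡⟨ cong (f 0 ⊕_) (Σ≤-cong n (λ k _ → pascal k)) ⟩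
  f 0 ⊕ Σ≤ n (λ k → a ⊗ h k ⊕ g (suc k))      ≡⟨ cong (f 0 ⊕_) (Σ≤-⊕ n (λ k → a ⊗ h k) (λ k → g (suc k))) ⟩
  g 0 ⊕ (Σ≤ n (λ k → a ⊗ h k) ⊕ G)            ≡⟨ cong (λ s → g 0 ⊕ (s ⊕ G)) (Σ≤-distribˡ n a h) ⟨
  g 0 ⊕ (a ⊗ translate y a n ⊕ G)             ≡⟨ rearrange (g 0) (a ⊗ translate y a n) G ⟩
  (g 0 ⊕ G) ⊕ a ⊗ translate y a n             ≡⟨ cong (_⊕ a ⊗ translate y a n) (Σ≤-suc n g) ⟨
  Σ≤ (suc n) g ⊕ a ⊗ translate y a n          ≡⟨ cong (_⊕ a ⊗ translate y a n) (translate-∘suc y a n) ⟩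
  translate (λ m → y (suc m)) a n ⊕ a ⊗ translate y a n ∎
  where
  open ≡-Reasoning
  f = λ k → fromℕ (suc n C k) ⊗ a ^′ k ⊗ y (suc n ∸ k)
  g = λ k → fromℕ (n C k) ⊗ a ^′ k ⊗ y (suc n ∸ k)
  h = λ k → fromℕ (n C k) ⊗ a ^′ k ⊗ y (n ∸ k)
  G = Σ≤ n (λ k → g (suc k))
  rearrange : ∀ p q r → p ⊕ (q ⊕ r) ≡ (p ⊕ r) ⊕ q
  rearrange = solve-∀ ℚ√5-ring
  split : ∀ a c d b e → (c ⊕ d) ⊗ (a ⊗ b) ⊗ e ≡ a ⊗ (c ⊗ b ⊗ e) ⊕ d ⊗ (a ⊗ b) ⊗ e
  split = solve-∀ ℚ√5-ring
  pascal : ∀ k → f (suc k) ≡ a ⊗ h k ⊕ g (suc k)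
  pascal k = begin
    f (suc k)
      ≡⟨ cong (λ c → fromℕ c ⊗ a ^′ suc k ⊗ y (n ∸ k)) (nCk+nC[k+1]≡[n+1]C[k+1] n k) ⟨
    fromℕ (n C k ℕ.+ n C suc k) ⊗ a ^′ suc k ⊗ y (n ∸ k)
      ≡⟨ cong (λ c → c ⊗ a ^′ suc k ⊗ y (n ∸ k)) (fromℕ-homo-+ (n C k) (n C suc k)) ⟩
    (fromℕ (n C k) ⊕ fromℕ (n C suc k)) ⊗ a ^′ suc k ⊗ y (n ∸ k)
      ≡⟨ split a (fromℕ (n C k)) (fromℕ (n C suc k)) (a ^′ k) (y (n ∸ k)) ⟩
    a ⊗ h k ⊕ g (suc k) ∎

translate-linear : ∀ y z c a n → translate (λ m → y m ⊕ c ⊗ z m) a n ≡ translate y a n ⊕ c ⊗ translate z a n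
translate-linear y z c a n = begin
  translate (λ m → y m ⊕ c ⊗ z m) a n    ≡⟨ Σ≤-cong n (λ k _ → distrib (coeff k) (y (n ∸ k)) c (z (n ∸ k))) ⟩
  Σ≤ n (λ k → coeff k ⊗ y (n ∸ k) ⊕ c ⊗ (coeff k ⊗ z (n ∸ k)))
                                         ≡⟨ Σ≤-⊕ n (λ k → coeff k ⊗ y (n ∸ k)) (λ k → c ⊗ (coeff k ⊗ z (n ∸ k))) ⟩
  translate y a n ⊕ Σ≤ n (λ k → c ⊗ (coeff k ⊗ z (n ∸ k)))
                                         ≡⟨ cong (translate y a n ⊕_) (Σ≤-distribˡ n c (λ k → coeff k ⊗ z (n ∸ k))) ⟨
  translate y a n ⊕ c ⊗ translate z a n  ∎
  where
  open ≡-Reasoning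
  coeff = λ k → fromℕ (n C k) ⊗ a ^′ k
  distrib : ∀ p u c v → p ⊗ (u ⊕ c ⊗ v) ≡ p ⊗ u ⊕ c ⊗ (p ⊗ v)
  distrib = solve-∀ ℚ√5-ring

-- The binomial theorem in disguise.
translate-⊕ : ∀ n y a b → translate y (a ⊕ b) n ≡ translate (translate y b) a n
translate-⊕ zero    y a b = unit (y 0)
  where
  unit : ∀ u → 1ℚ√5 ⊗ 1ℚ√5 ⊗ u ≡ 1ℚ√5 ⊗ 1ℚ√5 ⊗ (1ℚ√5 ⊗ 1ℚ√5 ⊗ u)
  unit = solve-∀ ℚ√5-ring
translate-⊕ (suc n) y a b = begin
  translate y (a ⊕ b) (suc n)                       ≡⟨ translate-suc y (a ⊕ b) n ⟩
  translate y↑ (a ⊕ b) n ⊕ (a ⊕ b) ⊗ translate y (a ⊕ b) n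
                                                    ≡⟨ cong₂ (λ p q → p ⊕ (a ⊕ b) ⊗ q) (translate-⊕ n y↑ a b) (translate-⊕ n y a b) ⟩
  translate w↑ a n ⊕ (a ⊕ b) ⊗ translate w a n      ≡⟨ rearrange (translate w↑ a n) a b (translate w a n) ⟩
  (translate w↑ a n ⊕ b ⊗ translate w a n) ⊕ a ⊗ translate w a n
                                                    ≡⟨ cong (_⊕ a ⊗ translate w a n) (translate-linear w↑ w b a n) ⟨
  translate (λ m → w↑ m ⊕ b ⊗ w m) a n ⊕ a ⊗ translate w a n
                                                    ≡⟨ cong (_⊕ a ⊗ translate w a n) (translate-cong n a (λ m → translate-suc y b m)) ⟨
  translate (λ m → w (suc m)) a n ⊕ a ⊗ translate w a n
                                                    ≡⟨ translate-suc w a n ⟨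
  translate w a (suc n)                             ∎
  where
  open ≡-Reasoning
  y↑ = λ m → y (suc m)
  w  = translate y b
  w↑ = translate y↑ b
  rearrange : ∀ X a b W → X ⊕ (a ⊕ b) ⊗ W ≡ (X ⊕ b ⊗ W) ⊕ a ⊗ W
  rearrange = solve-∀ ℚ√5-ring

translate-zero : ∀ a n → translate (λ _ → 0ℚ√5) a n ≡ 0ℚ√5
translate-zero a n = trans (Σ≤-cong n (λ k _ → annihilate (fromℕ (n C k)) (a ^′ k))) (Σ≤-zero n)
  where
  annihilate : ∀ i p → i ⊗ p ⊗ 0ℚ√5 ≡ 0ℚ√5
  annihilate = solve-∀ ℚ√5-ring

δ₀ : ℚ√5 → ℕ → ℚ√5
δ₀ c zero    = c
δ₀ c (suc m) = 0ℚ√5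

δ₁ : ℚ√5 → ℕ → ℚ√5
δ₁ c zero    = 0ℚ√5
δ₁ c (suc m) = δ₀ c m

translate-δ₀ : ∀ c a n → translate (δ₀ c) a n ≡ a ^′ n ⊗ c
translate-δ₀ c a zero    = unit c
  where
  unit : ∀ c → 1ℚ√5 ⊗ 1ℚ√5 ⊗ c ≡ 1ℚ√5 ⊗ c
  unit = solve-∀ ℚ√5-ring
translate-δ₀ c a (suc n) = begin
  translate (δ₀ c) a (suc n)                            ≡⟨ translate-suc (δ₀ c) a n ⟩
  translate (λ _ → 0ℚ√5) a n ⊕ a ⊗ translate (δ₀ c) a n ≡⟨ cong₂ (λ p q → p ⊕ a ⊗ q) (translate-zero a n) (translate-δ₀ c a n) ⟩
  0ℚ√5 ⊕ a ⊗ (a ^′ n ⊗ c)                               ≡⟨ rearrange a (a ^′ n) c ⟩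
  a ^′ suc n ⊗ c                                        ∎
  where
  open ≡-Reasoning
  rearrange : ∀ a p c → 0ℚ√5 ⊕ a ⊗ (p ⊗ c) ≡ (a ⊗ p) ⊗ c
  rearrange = solve-∀ ℚ√5-ring

-- n ∸ 1 is truncated, but at n = 0 the factor fromℕ n vanishes anyway.
translate-δ₁ : ∀ c a n → translate (δ₁ c) a n ≡ fromℕ n ⊗ c ⊗ a ^′ (n ∸ 1)
translate-δ₁ c a zero    = vanish c
  where
  vanish : ∀ c → 1ℚ√5 ⊗ 1ℚ√5 ⊗ 0ℚ√5 ≡ 0ℚ√5 ⊗ c ⊗ 1ℚ√5
  vanish = solve-∀ ℚ√5-ring
translate-δ₁ c a (suc n) = begin
  translate (δ₁ c) a (suc n)                                ≡⟨ translate-suc (δ₁ c) a n ⟩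
  translate (δ₀ c) a n ⊕ a ⊗ translate (δ₁ c) a n           ≡⟨ cong₂ (λ p q → p ⊕ a ⊗ q) (translate-δ₀ c a n) (translate-δ₁ c a n) ⟩
  a ^′ n ⊗ c ⊕ a ⊗ (fromℕ n ⊗ c ⊗ a ^′ (n ∸ 1))             ≡⟨ collect n ⟩
  fromℕ (suc n) ⊗ c ⊗ a ^′ n                                ∎
  where
  open ≡-Reasoning
  base : ∀ a c → 1ℚ√5 ⊗ c ⊕ a ⊗ (0ℚ√5 ⊗ c ⊗ 1ℚ√5) ≡ 1ℚ√5 ⊗ c ⊗ 1ℚ√5
  base = solve-∀ ℚ√5-ring
  step : ∀ a p c i → (a ⊗ p) ⊗ c ⊕ a ⊗ (i ⊗ c ⊗ p) ≡ (1ℚ√5 ⊕ i) ⊗ c ⊗ (a ⊗ p)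
  step = solve-∀ ℚ√5-ring
  collect : ∀ n → a ^′ n ⊗ c ⊕ a ⊗ (fromℕ n ⊗ c ⊗ a ^′ (n ∸ 1)) ≡ fromℕ (suc n) ⊗ c ⊗ a ^′ n
  collect zero    = base a c
  collect (suc n) = trans (step a (a ^′ n) c (fromℕ (suc n)))
                          (cong (λ i → i ⊗ c ⊗ a ^′ suc n) (sym (fromℕ-homo-+ 1 (suc n))))

bernList≡applyUpTo : ∀ m → bernList m ≡ applyUpTo bernoulli m
bernList≡applyUpTo zero    = refl
bernList≡applyUpTo (suc m) =
  trans (cong (_++ [ bernoulli m ]) (bernList≡applyUpTo m)) (applyUpTo-∷ʳ bernoulli m)

zipWith-applyUpTo : ∀ {A B C : Set} (h : A → B → C) f g n →
                    zipWith h (applyUpTo f n) (applyUpTo g n) ≡ applyUpTo (λ k → h (f k) (g k)) n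
zipWith-applyUpTo h f g zero    = refl
zipWith-applyUpTo h f g (suc n) = cong (h (f 0) (g 0) ∷_) (zipWith-applyUpTo h (λ k → f (suc k)) (λ k → g (suc k)) n)

emb-sumℚ-applyUpTo : ∀ f m → emb (sumℚ (applyUpTo f (suc m))) ≡ Σ≤ m (λ k → emb (f k))
emb-sumℚ-applyUpTo f zero    = ℚ.+-identityʳ (f 0) ≡√5 refl
emb-sumℚ-applyUpTo f (suc m) = begin
  emb (f 0 + sumℚ (applyUpTo f↑ (suc m)))       ≡⟨ emb-homo-+ (f 0) _ ⟩
  emb (f 0) ⊕ emb (sumℚ (applyUpTo f↑ (suc m))) ≡⟨ cong (emb (f 0) ⊕_) (emb-sumℚ-applyUpTo f↑ m) ⟩
  emb (f 0) ⊕ Σ≤ m (λ k → emb (f↑ k))           ≡⟨ Σ≤-suc m (λ k → emb (f k)) ⟨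
  Σ≤ (suc m) (λ k → emb (f k))                  ∎
  where
  open ≡-Reasoning
  f↑ = λ k → f (suc k)

bernoulli-suc : ∀ m → bernoulli (suc m) ≡
                - ((+ 1 / (2 ℕ.+ m)) * sumℚ (applyUpTo (λ k → ℕ→ℚ ((2 ℕ.+ m) C k) * bernoulli k) (suc m)))
bernoulli-suc m = cong (λ bs → - ((+ 1 / (2 ℕ.+ m)) * sumℚ bs))
  (trans (cong (zipWith term (upTo (suc m))) (bernList≡applyUpTo (suc m)))
         (zipWith-applyUpTo term (λ k → k) bernoulli (suc m)))
  where
  term = λ k b → ℕ→ℚ ((2 ℕ.+ m) C k) * b

bernoulli-recurrence : ∀ m → Σ≤ (suc m) (λ k → fromℕ ((2 ℕ.+ m) C k) ⊗ emb (bernoulli k)) ≡ 0ℚ√5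
bernoulli-recurrence m = begin
  Σ≤ m f ⊕ fromℕ (N C suc m) ⊗ emb (bernoulli (suc m))  ≡⟨ cong₂ (λ s c → s ⊕ fromℕ c ⊗ emb (bernoulli (suc m))) head C[N,N-1] ⟩
  emb S ⊕ fromℕ N ⊗ emb (bernoulli (suc m))            ≡⟨ cong (λ b → emb S ⊕ fromℕ N ⊗ emb b) (bernoulli-suc m) ⟩
  emb S ⊕ fromℕ N ⊗ emb (- (q * S))                    ≡⟨ cong (emb S ⊕_) (emb-homo-* (ℕ→ℚ N) (- (q * S))) ⟨
  emb S ⊕ emb (ℕ→ℚ N * - (q * S))                      ≡⟨ emb-homo-+ S (ℕ→ℚ N * - (q * S)) ⟨
  emb (S + ℕ→ℚ N * - (q * S))                          ≡⟨ cong emb (trans (pull S (ℕ→ℚ N) q) (cong (λ r → S + - (r * S)) (ℕ→ℚ-*-inverse (suc m)))) ⟩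
  emb (S + - (1ℚ * S))                                 ≡⟨ cong emb (cancel S) ⟩
  0ℚ√5                                                 ∎
  where
  open ≡-Reasoning
  N = 2 ℕ.+ m
  q = + 1 / N
  f = λ k → fromℕ (N C k) ⊗ emb (bernoulli k)
  S = sumℚ (applyUpTo (λ k → ℕ→ℚ (N C k) * bernoulli k) (suc m))
  head : Σ≤ m f ≡ emb S
  head = sym (trans (emb-sumℚ-applyUpTo (λ k → ℕ→ℚ (N C k) * bernoulli k) m)
                    (Σ≤-cong m (λ k _ → emb-homo-* (ℕ→ℚ (N C k)) (bernoulli k))))
  C[N,N-1] : N C suc m ≡ N
  C[N,N-1] = trans (nCk≡nC[n∸k] (ℕₚ.n≤1+n (suc m))) (trans (cong (N C_) (ℕₚ.m+n∸n≡m 1 m)) (nC1≡n N))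
  pull : ∀ S t q → S + t * - (q * S) ≡ S + - ((t * q) * S)
  pull = solve-∀ ℚ-ring
  cancel : ∀ S → S + - (1ℚ * S) ≡ 0ℚ
  cancel = solve-∀ ℚ-ring

bernoulli-binomialSum : ∀ m → Σ≤ m (λ r → fromℕ (m C r) ⊗ emb (bernoulli r)) ≡ emb (bernoulli m) ⊕ δ₁ 1ℚ√5 m
bernoulli-binomialSum zero          = unit (emb (bernoulli 0))
  where
  unit : ∀ e → 1ℚ√5 ⊗ e ≡ e ⊕ 0ℚ√5
  unit = solve-∀ ℚ√5-ring
bernoulli-binomialSum (suc zero)    = swap (emb (bernoulli 1))
  where
  swap : ∀ e → 1ℚ√5 ⊗ 1ℚ√5 ⊕ 1ℚ√5 ⊗ e ≡ e ⊕ 1ℚ√5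
  swap = solve-∀ ℚ√5-ring
bernoulli-binomialSum (suc (suc m)) =
  trans (cong₂ (λ s c → s ⊕ fromℕ c ⊗ emb (bernoulli N)) (bernoulli-recurrence m) (nCn≡1 N)) (unit (emb (bernoulli N)))
  where
  N = 2 ℕ.+ m
  unit : ∀ e → 0ℚ√5 ⊕ 1ℚ√5 ⊗ e ≡ e ⊕ 0ℚ√5
  unit = solve-∀ ℚ√5-ring

scaledBernoulli : ℚ√5 → ℕ → ℚ√5
scaledBernoulli x m = x ^′ m ⊗ emb (bernoulli m)

translate-scaledBernoulli-self : ∀ x m → translate (scaledBernoulli x) x m ≡ scaledBernoulli x m ⊕ δ₁ x m
translate-scaledBernoulli-self x m = begin
  translate (scaledBernoulli x) x m                          ≡⟨ Σ≤-cong m factor ⟩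
  Σ≤ m (λ k → x ^′ m ⊗ (fromℕ (m C (m ∸ k)) ⊗ β (m ∸ k)))    ≡⟨ Σ≤-distribˡ m (x ^′ m) (λ k → fromℕ (m C (m ∸ k)) ⊗ β (m ∸ k)) ⟨
  x ^′ m ⊗ Σ≤ m (λ k → fromℕ (m C (m ∸ k)) ⊗ β (m ∸ k))      ≡⟨ cong (x ^′ m ⊗_) (Σ≤-reverse m (λ r → fromℕ (m C r) ⊗ β r)) ⟩
  x ^′ m ⊗ Σ≤ m (λ r → fromℕ (m C r) ⊗ β r)                  ≡⟨ cong (x ^′ m ⊗_) (bernoulli-binomialSum m) ⟩
  x ^′ m ⊗ (β m ⊕ δ₁ 1ℚ√5 m)                                 ≡⟨ expand m ⟩
  scaledBernoulli x m ⊕ δ₁ x m                               ∎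
  where
  open ≡-Reasoning
  β = λ r → emb (bernoulli r)
  regroup : ∀ i p q b → i ⊗ p ⊗ (q ⊗ b) ≡ (p ⊗ q) ⊗ (i ⊗ b)
  regroup = solve-∀ ℚ√5-ring
  factor : ∀ k → k ≤ m → fromℕ (m C k) ⊗ x ^′ k ⊗ scaledBernoulli x (m ∸ k) ≡ x ^′ m ⊗ (fromℕ (m C (m ∸ k)) ⊗ β (m ∸ k))
  factor k k≤m = trans (regroup (fromℕ (m C k)) (x ^′ k) (x ^′ (m ∸ k)) (β (m ∸ k)))
    (cong₂ (λ p c → p ⊗ (fromℕ c ⊗ β (m ∸ k)))
           (trans (sym (^′-homo-⊗ x k (m ∸ k))) (cong (x ^′_) (ℕₚ.m+[n∸m]≡n k≤m)))
           (nCk≡nC[n∸k] k≤m))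
  expand₀ : ∀ b → 1ℚ√5 ⊗ (b ⊕ 0ℚ√5) ≡ 1ℚ√5 ⊗ b ⊕ 0ℚ√5
  expand₀ = solve-∀ ℚ√5-ring
  expand₁ : ∀ x b → x ⊗ 1ℚ√5 ⊗ (b ⊕ 1ℚ√5) ≡ x ⊗ 1ℚ√5 ⊗ b ⊕ x
  expand₁ = solve-∀ ℚ√5-ring
  expand₂ : ∀ p b → p ⊗ (b ⊕ 0ℚ√5) ≡ p ⊗ b ⊕ 0ℚ√5
  expand₂ = solve-∀ ℚ√5-ring
  expand : ∀ m → x ^′ m ⊗ (β m ⊕ δ₁ 1ℚ√5 m) ≡ scaledBernoulli x m ⊕ δ₁ x m
  expand zero          = expand₀ (β 0)
  expand (suc zero)    = expand₁ x (β 1)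
  expand (suc (suc m)) = expand₂ (x ^′ (2 ℕ.+ m)) (β (2 ℕ.+ m))

-- The homogenised form of Bₙ(t + 1) − Bₙ(t) = n tⁿ⁻¹.
translate-scaledBernoulli-shift : ∀ x a n →
  translate (scaledBernoulli x) (a ⊕ x) n ≡ translate (scaledBernoulli x) a n ⊕ fromℕ n ⊗ x ⊗ a ^′ (n ∸ 1)
translate-scaledBernoulli-shift x a n = begin
  translate y (a ⊕ x) n                               ≡⟨ translate-⊕ n y a x ⟩
  translate (translate y x) a n                       ≡⟨ translate-cong n a (λ m → trans (translate-scaledBernoulli-self x m) (unitˡ (y m) (δ₁ x m))) ⟩
  translate (λ m → y m ⊕ 1ℚ√5 ⊗ δ₁ x m) a n           ≡⟨ translate-linear y (δ₁ x) 1ℚ√5 a n ⟩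
  translate y a n ⊕ 1ℚ√5 ⊗ translate (δ₁ x) a n       ≡⟨ cong (λ t → translate y a n ⊕ 1ℚ√5 ⊗ t) (translate-δ₁ x a n) ⟩
  translate y a n ⊕ 1ℚ√5 ⊗ (fromℕ n ⊗ x ⊗ a ^′ (n ∸ 1)) ≡⟨ cong (translate y a n ⊕_) (⊗-identityˡ (fromℕ n ⊗ x ⊗ a ^′ (n ∸ 1))) ⟩
  translate y a n ⊕ fromℕ n ⊗ x ⊗ a ^′ (n ∸ 1)        ∎
  where
  open ≡-Reasoning
  y = scaledBernoulli x
  unitˡ : ∀ p q → p ⊕ q ≡ p ⊕ 1ℚ√5 ⊗ q
  unitˡ = solve-∀ ℚ√5-ring

-- Bₙ(t + 2) − Bₙ(t) = n (tⁿ⁻¹ + (t + 1)ⁿ⁻¹).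
translate-scaledBernoulli-shift₂ : ∀ x c n →
  translate (scaledBernoulli x) ((c ⊕ x) ⊕ x) n ⊕ neg (translate (scaledBernoulli x) c n)
    ≡ fromℕ n ⊗ x ⊗ (c ^′ (n ∸ 1) ⊕ (c ⊕ x) ^′ (n ∸ 1))
translate-scaledBernoulli-shift₂ x c n = begin
  translate y ((c ⊕ x) ⊕ x) n ⊕ neg (translate y c n)
    ≡⟨ cong (_⊕ neg (translate y c n)) (translate-scaledBernoulli-shift x (c ⊕ x) n) ⟩
  (translate y (c ⊕ x) n ⊕ fromℕ n ⊗ x ⊗ (c ⊕ x) ^′ (n ∸ 1)) ⊕ neg (translate y c n)
    ≡⟨ cong (λ t → (t ⊕ fromℕ n ⊗ x ⊗ (c ⊕ x) ^′ (n ∸ 1)) ⊕ neg (translate y c n)) (translate-scaledBernoulli-shift x c n) ⟩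
  ((translate y c n ⊕ fromℕ n ⊗ x ⊗ c ^′ (n ∸ 1)) ⊕ fromℕ n ⊗ x ⊗ (c ⊕ x) ^′ (n ∸ 1)) ⊕ neg (translate y c n)
    ≡⟨ telescope (translate y c n) (fromℕ n ⊗ x) (c ^′ (n ∸ 1)) ((c ⊕ x) ^′ (n ∸ 1)) ⟩
  fromℕ n ⊗ x ⊗ (c ^′ (n ∸ 1) ⊕ (c ⊕ x) ^′ (n ∸ 1)) ∎
  where
  open ≡-Reasoning
  y = scaledBernoulli x
  telescope : ∀ t u p q → ((t ⊕ u ⊗ p) ⊕ u ⊗ q) ⊕ neg t ≡ u ⊗ (p ⊕ q)
  telescope = solve-∀ ℚ√5-ring

record IsFibonacciLike (u : ℕ → ℚ√5) : Set where
  constructor fibonacciLike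
  field recurrence : ∀ m → u (2 ℕ.+ m) ≡ u (suc m) ⊕ u m

fibonacciLike-unique : ∀ {u v} → IsFibonacciLike u → IsFibonacciLike v →
                       u 0 ≡ v 0 → u 1 ≡ v 1 → ∀ m → u m ≡ v m
fibonacciLike-unique fu fv u₀ u₁ zero          = u₀
fibonacciLike-unique fu fv u₀ u₁ (suc zero)    = u₁
fibonacciLike-unique fu fv u₀ u₁ (suc (suc m)) =
  trans (recurrence fu m) (trans (cong₂ _⊕_ (unique (suc m)) (unique m)) (sym (recurrence fv m)))
  where
  open IsFibonacciLike
  unique = fibonacciLike-unique fu fv u₀ u₁

fibonacciLike-⊕ : ∀ {u v} → IsFibonacciLike u → IsFibonacciLike v → IsFibonacciLike (λ m → u m ⊕ v m)
fibonacciLike-⊕ {u} {v} (fibonacciLike fu) (fibonacciLike fv) = fibonacciLike λ m →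
  trans (cong₂ _⊕_ (fu m) (fv m)) (interchange (u (suc m)) (u m) (v (suc m)) (v m))
  where
  interchange : ∀ a b c d → (a ⊕ b) ⊕ (c ⊕ d) ≡ (a ⊕ c) ⊕ (b ⊕ d)
  interchange = solve-∀ ℚ√5-ring

fibonacciLike-neg : ∀ {u} → IsFibonacciLike u → IsFibonacciLike (λ m → neg (u m))
fibonacciLike-neg {u} (fibonacciLike fu) = fibonacciLike λ m →
  trans (cong neg (fu m)) (neg-distrib (u (suc m)) (u m))
  where
  neg-distrib : ∀ a b → neg (a ⊕ b) ≡ neg a ⊕ neg b
  neg-distrib = solve-∀ ℚ√5-ring

fibonacciLike-scale : ∀ c {u} → IsFibonacciLike u → IsFibonacciLike (λ m → c ⊗ u m)
fibonacciLike-scale c {u} (fibonacciLike fu) = fibonacciLike λ m →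
  trans (cong (c ⊗_) (fu m)) (⊗-distribˡ-⊕ c (u (suc m)) (u m))

fibonacciLike-^′ : ∀ {x} → x ⊗ x ≡ x ⊕ 1ℚ√5 → IsFibonacciLike (x ^′_)
fibonacciLike-^′ {x} x²≡x+1 = fibonacciLike λ m → begin
  x ⊗ (x ⊗ x ^′ m)        ≡⟨ ⊗-assoc x x (x ^′ m) ⟨
  (x ⊗ x) ⊗ x ^′ m        ≡⟨ cong (_⊗ x ^′ m) x²≡x+1 ⟩
  (x ⊕ 1ℚ√5) ⊗ x ^′ m     ≡⟨ expand x (x ^′ m) ⟩
  x ⊗ x ^′ m ⊕ x ^′ m     ∎
  where
  open ≡-Reasoning
  expand : ∀ a b → (a ⊕ 1ℚ√5) ⊗ b ≡ a ⊗ b ⊕ b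
  expand = solve-∀ ℚ√5-ring

fibonacciLike-fib : IsFibonacciLike (λ m → fromℕ (fib m))
fibonacciLike-fib = fibonacciLike λ m → fromℕ-homo-+ (fib (suc m)) (fib m)

fibonacciLike-luc : IsFibonacciLike (λ m → fromℕ (luc m))
fibonacciLike-luc = fibonacciLike λ m → fromℕ-homo-+ (luc (suc m)) (luc m)

-- The roots of x² = x + 1; the refl proofs below are closed computations in ℚ(√5).
φ ψ : ℚ√5
φ = (+ 1 / 2) +√5· (+ 1 / 2)
ψ = (+ 1 / 2) +√5· (- (+ 1 / 2))

binet-luc : ∀ m → fromℕ (luc m) ≡ φ ^′ m ⊕ ψ ^′ m
binet-luc = fibonacciLike-unique fibonacciLike-luc
  (fibonacciLike-⊕ (fibonacciLike-^′ refl) (fibonacciLike-^′ refl)) refl refl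

binet-fib : ∀ m → √5 ⊗ fromℕ (fib m) ≡ φ ^′ m ⊕ neg (ψ ^′ m)
binet-fib = fibonacciLike-unique (fibonacciLike-scale √5 fibonacciLike-fib)
  (fibonacciLike-⊕ (fibonacciLike-^′ refl) (fibonacciLike-neg (fibonacciLike-^′ refl))) refl refl

lucas⊕√5fib : ∀ m → fromℕ (luc m) ⊕ √5 ⊗ fromℕ (fib m) ≡ fromℕ 2 ⊗ φ ^′ m
lucas⊕√5fib m = trans (cong₂ _⊕_ (binet-luc m) (binet-fib m)) (double (φ ^′ m) (ψ ^′ m))
  where
  double : ∀ p q → (p ⊕ q) ⊕ (p ⊕ neg q) ≡ (1ℚ√5 ⊕ 1ℚ√5) ⊗ p
  double = solve-∀ ℚ√5-ring

lucas⊖√5fib : ∀ m → fromℕ (luc m) ⊕ neg (√5 ⊗ fromℕ (fib m)) ≡ fromℕ 2 ⊗ ψ ^′ m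
lucas⊖√5fib m = trans (cong₂ (λ l f → l ⊕ neg f) (binet-luc m) (binet-fib m)) (double (φ ^′ m) (ψ ^′ m))
  where
  double : ∀ p q → (p ⊕ q) ⊕ neg (p ⊕ neg q) ≡ (1ℚ√5 ⊕ 1ℚ√5) ⊗ q
  double = solve-∀ ℚ√5-ring

binet-power : ∀ j k → √5 ⊗ fromℕ (2 ℕ.^ k) ⊗ fromℕ (fib (j ℕ.* k)) ≡
  (fromℕ (luc j) ⊕ √5 ⊗ fromℕ (fib j)) ^′ k ⊕ neg ((fromℕ (luc j) ⊕ neg (√5 ⊗ fromℕ (fib j))) ^′ k)
binet-power j k = begin
  √5 ⊗ fromℕ (2 ℕ.^ k) ⊗ fromℕ (fib (j ℕ.* k))      ≡⟨ cong (λ t → √5 ⊗ t ⊗ fromℕ (fib (j ℕ.* k))) (fromℕ-homo-^ 2 k) ⟩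
  √5 ⊗ two ^′ k ⊗ fromℕ (fib (j ℕ.* k))              ≡⟨ reorder √5 (two ^′ k) (fromℕ (fib (j ℕ.* k))) ⟩
  two ^′ k ⊗ (√5 ⊗ fromℕ (fib (j ℕ.* k)))            ≡⟨ cong (two ^′ k ⊗_) (binet-fib (j ℕ.* k)) ⟩
  two ^′ k ⊗ (φ ^′ (j ℕ.* k) ⊕ neg (ψ ^′ (j ℕ.* k))) ≡⟨ cong₂ (λ p q → two ^′ k ⊗ (p ⊕ neg q)) (^′-assocʳ φ j k) (^′-assocʳ ψ j k) ⟨
  two ^′ k ⊗ ((φ ^′ j) ^′ k ⊕ neg ((ψ ^′ j) ^′ k))   ≡⟨ distrib (two ^′ k) ((φ ^′ j) ^′ k) ((ψ ^′ j) ^′ k) ⟩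
  two ^′ k ⊗ (φ ^′ j) ^′ k ⊕ neg (two ^′ k ⊗ (ψ ^′ j) ^′ k)
                                                     ≡⟨ cong₂ (λ p q → p ⊕ neg q) (^′-distrib-⊗ two (φ ^′ j) k) (^′-distrib-⊗ two (ψ ^′ j) k) ⟨
  (two ⊗ φ ^′ j) ^′ k ⊕ neg ((two ⊗ ψ ^′ j) ^′ k)    ≡⟨ cong₂ (λ p q → p ^′ k ⊕ neg (q ^′ k)) (lucas⊕√5fib j) (lucas⊖√5fib j) ⟨
  (fromℕ (luc j) ⊕ √5 ⊗ fromℕ (fib j)) ^′ k ⊕ neg ((fromℕ (luc j) ⊕ neg (√5 ⊗ fromℕ (fib j))) ^′ k) ∎
  where
  open ≡-Reasoning
  two = fromℕ 2
  reorder : ∀ a b c → a ⊗ b ⊗ c ≡ b ⊗ (a ⊗ c)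
  reorder = solve-∀ ℚ√5-ring
  distrib : ∀ a p q → a ⊗ (p ⊕ neg q) ≡ a ⊗ p ⊕ neg (a ⊗ q)
  distrib = solve-∀ ℚ√5-ring

√5± : Sign → ℚ√5
√5± s = emb (signℚ s) ⊗ √5

√5±-invertible : ∀ s → (√5± s ⊗ emb (+ 1 / 5)) ⊗ √5± s ≡ 1ℚ√5
√5±-invertible Sign.+ = refl
√5±-invertible Sign.- = refl

neg-√5± : ∀ s → emb (- signℚ s) ⊗ √5 ≡ neg (√5± s)
neg-√5± Sign.+ = refl
neg-√5± Sign.- = refl

binet-power± : ∀ s j k → let L = fromℕ (luc j); X = √5± s ⊗ fromℕ (fib j) in
  √5± s ⊗ fromℕ (2 ℕ.^ k) ⊗ fromℕ (fib (j ℕ.* k)) ≡ (L ⊕ X) ^′ k ⊕ neg ((L ⊕ neg X) ^′ k)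
binet-power± Sign.+ j k = binet-power j k  -- √5± Sign.+ computes to √5
binet-power± Sign.- j k = begin
  √5± Sign.- ⊗ P ⊗ F′                                         ≡⟨ negate P F′ ⟩
  neg (√5 ⊗ P ⊗ F′)                                           ≡⟨ cong neg (binet-power j k) ⟩
  neg ((L ⊕ √5 ⊗ F) ^′ k ⊕ neg ((L ⊕ neg (√5 ⊗ F)) ^′ k))     ≡⟨ swap ((L ⊕ √5 ⊗ F) ^′ k) ((L ⊕ neg (√5 ⊗ F)) ^′ k) ⟩
  (L ⊕ neg (√5 ⊗ F)) ^′ k ⊕ neg ((L ⊕ √5 ⊗ F) ^′ k)           ≡⟨ cong₂ (λ a b → a ^′ k ⊕ neg (b ^′ k)) (minus L F) (plus L F) ⟨
  (L ⊕ X) ^′ k ⊕ neg ((L ⊕ neg X) ^′ k)                       ∎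
  where
  open ≡-Reasoning
  L = fromℕ (luc j)
  F = fromℕ (fib j)
  X = √5± Sign.- ⊗ F
  P = fromℕ (2 ℕ.^ k)
  F′ = fromℕ (fib (j ℕ.* k))
  negate : ∀ a b → emb (- 1ℚ) ⊗ √5 ⊗ a ⊗ b ≡ neg (√5 ⊗ a ⊗ b)
  negate = solve-∀ ℚ√5-ring
  swap : ∀ a b → neg (a ⊕ neg b) ≡ b ⊕ neg a
  swap = solve-∀ ℚ√5-ring
  minus : ∀ l f → l ⊕ emb (- 1ℚ) ⊗ √5 ⊗ f ≡ l ⊕ neg (√5 ⊗ f)
  minus = solve-∀ ℚ√5-ring
  plus : ∀ l f → l ⊕ neg (emb (- 1ℚ) ⊗ √5 ⊗ f) ≡ l ⊕ √5 ⊗ f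
  plus = solve-∀ ℚ√5-ring

lhs-as-translates : ∀ s n j → let L = fromℕ (luc j); X = √5± s ⊗ fromℕ (fib j) in
  √5± s ⊗ lhs s n j ≡ translate (scaledBernoulli X) (L ⊕ X) n ⊕ neg (translate (scaledBernoulli X) (L ⊕ neg X) n)
lhs-as-translates s n j = begin
  √5± s ⊗ lhs s n j                    ≡⟨ Σ≤-distribˡ n (√5± s) t ⟩
  Σ≤ n (λ k → √5± s ⊗ t k)             ≡⟨ Σ≤-cong n (λ k _ → term k) ⟩
  Σ≤ n (λ k → u k ⊕ neg (v k))         ≡⟨ Σ≤-⊕ n u (λ k → neg (v k)) ⟩
  Σ≤ n u ⊕ Σ≤ n (λ k → neg (v k))      ≡⟨ cong (Σ≤ n u ⊕_) (Σ≤-neg n v) ⟩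
  Σ≤ n u ⊕ neg (Σ≤ n v)                ∎
  where
  open ≡-Reasoning
  L = fromℕ (luc j)
  X = √5± s ⊗ fromℕ (fib j)
  y = scaledBernoulli X
  binom = λ k → fromℕ (n C k)
  t = λ k → emb (ℕ→ℚ (n C k) * ℕ→ℚ (2 ℕ.^ k) * ℕ→ℚ (fib (j ℕ.* k))) ⊗ X ^′ (n ∸ k) ⊗ emb (bernoulli (n ∸ k))
  u = λ k → binom k ⊗ (L ⊕ X) ^′ k ⊗ y (n ∸ k)
  v = λ k → binom k ⊗ (L ⊕ neg X) ^′ k ⊗ y (n ∸ k)
  regroup : ∀ r c p f x b → r ⊗ (c ⊗ p ⊗ f ⊗ x ⊗ b) ≡ c ⊗ (r ⊗ p ⊗ f) ⊗ (x ⊗ b)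
  regroup = solve-∀ ℚ√5-ring
  distrib : ∀ c p q y → c ⊗ (p ⊕ neg q) ⊗ y ≡ c ⊗ p ⊗ y ⊕ neg (c ⊗ q ⊗ y)
  distrib = solve-∀ ℚ√5-ring
  term : ∀ k → √5± s ⊗ t k ≡ u k ⊕ neg (v k)
  term k = begin
    √5± s ⊗ t k
      ≡⟨ cong (λ e → √5± s ⊗ (e ⊗ X ^′ (n ∸ k) ⊗ emb (bernoulli (n ∸ k))))
              (trans (emb-homo-* (ℕ→ℚ (n C k) * ℕ→ℚ (2 ℕ.^ k)) (ℕ→ℚ (fib (j ℕ.* k))))
                     (cong (_⊗ fromℕ (fib (j ℕ.* k))) (emb-homo-* (ℕ→ℚ (n C k)) (ℕ→ℚ (2 ℕ.^ k))))) ⟩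
    √5± s ⊗ (binom k ⊗ fromℕ (2 ℕ.^ k) ⊗ fromℕ (fib (j ℕ.* k)) ⊗ X ^′ (n ∸ k) ⊗ emb (bernoulli (n ∸ k)))
      ≡⟨ regroup (√5± s) (binom k) (fromℕ (2 ℕ.^ k)) (fromℕ (fib (j ℕ.* k))) (X ^′ (n ∸ k)) (emb (bernoulli (n ∸ k))) ⟩
    binom k ⊗ (√5± s ⊗ fromℕ (2 ℕ.^ k) ⊗ fromℕ (fib (j ℕ.* k))) ⊗ y (n ∸ k)
      ≡⟨ cong (λ e → binom k ⊗ e ⊗ y (n ∸ k)) (binet-power± s j k) ⟩
    binom k ⊗ ((L ⊕ X) ^′ k ⊕ neg ((L ⊕ neg X) ^′ k)) ⊗ y (n ∸ k)
      ≡⟨ distrib (binom k) ((L ⊕ X) ^′ k) ((L ⊕ neg X) ^′ k) (y (n ∸ k)) ⟩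
    u k ⊕ neg (v k) ∎

rhs-scaled : ∀ s n j → let L = fromℕ (luc j); X = √5± s ⊗ fromℕ (fib j) in
  √5± s ⊗ rhs s n j ≡ fromℕ n ⊗ X ⊗ ((L ⊕ neg X) ^′ (n ∸ 1) ⊕ L ^′ (n ∸ 1))
rhs-scaled s n j = begin
  √5± s ⊗ (emb (ℕ→ℚ n * ℕ→ℚ (fib j)) ⊗ (L ^′ (n ∸ 1) ⊕ (emb (- signℚ s) ⊗ √5 ⊗ F ⊕ L) ^′ (n ∸ 1)))
    ≡⟨ cong₂ (λ e r → √5± s ⊗ (e ⊗ (L ^′ (n ∸ 1) ⊕ (r ⊗ F ⊕ L) ^′ (n ∸ 1)))) (emb-homo-* (ℕ→ℚ n) (ℕ→ℚ (fib j))) (neg-√5± s) ⟩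
  √5± s ⊗ (fromℕ n ⊗ F ⊗ (L ^′ (n ∸ 1) ⊕ (neg (√5± s) ⊗ F ⊕ L) ^′ (n ∸ 1)))
    ≡⟨ cong (λ c → √5± s ⊗ (fromℕ n ⊗ F ⊗ (L ^′ (n ∸ 1) ⊕ c ^′ (n ∸ 1)))) (flip (√5± s) F L) ⟩
  √5± s ⊗ (fromℕ n ⊗ F ⊗ (L ^′ (n ∸ 1) ⊕ (L ⊕ neg X) ^′ (n ∸ 1)))
    ≡⟨ regroup (√5± s) (fromℕ n) F (L ^′ (n ∸ 1)) ((L ⊕ neg X) ^′ (n ∸ 1)) ⟩
  fromℕ n ⊗ X ⊗ ((L ⊕ neg X) ^′ (n ∸ 1) ⊕ L ^′ (n ∸ 1)) ∎
  where
  open ≡-Reasoning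
  L = fromℕ (luc j)
  F = fromℕ (fib j)
  X = √5± s ⊗ F
  flip : ∀ r f l → neg r ⊗ f ⊕ l ≡ l ⊕ neg (r ⊗ f)
  flip = solve-∀ ℚ√5-ring
  regroup : ∀ r i f p q → r ⊗ (i ⊗ f ⊗ (p ⊕ q)) ≡ i ⊗ (r ⊗ f) ⊗ (q ⊕ p)
  regroup = solve-∀ ℚ√5-ring

corollary18 : (s : Sign) (n j : ℕ) → j ≥ 1 → lhs s n j ≡ rhs s n j
corollary18 s n j _ = ⊗-cancelˡ (√5± s ⊗ emb (+ 1 / 5)) (√5± s) (√5±-invertible s) (begin
  √5± s ⊗ lhs s n j                                   ≡⟨ lhs-as-translates s n j ⟩
  translate y (L ⊕ X) n ⊕ neg (translate y c n)       ≡⟨ cong (λ a → translate y a n ⊕ neg (translate y c n)) (recentre L X) ⟩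
  translate y ((c ⊕ X) ⊕ X) n ⊕ neg (translate y c n) ≡⟨ translate-scaledBernoulli-shift₂ X c n ⟩
  fromℕ n ⊗ X ⊗ (c ^′ (n ∸ 1) ⊕ (c ⊕ X) ^′ (n ∸ 1))   ≡⟨ cong (λ a → fromℕ n ⊗ X ⊗ (c ^′ (n ∸ 1) ⊕ a ^′ (n ∸ 1))) (cancel L X) ⟩
  fromℕ n ⊗ X ⊗ (c ^′ (n ∸ 1) ⊕ L ^′ (n ∸ 1))         ≡⟨ rhs-scaled s n j ⟨
  √5± s ⊗ rhs s n j                                   ∎)
  where
  open ≡-Reasoning
  L = fromℕ (luc j)
  X = √5± s ⊗ fromℕ (fib j)
  c = L ⊕ neg X
  y = scaledBernoulli X
  recentre : ∀ l x → l ⊕ x ≡ ((l ⊕ neg x) ⊕ x) ⊕ x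
  recentre = solve-∀ ℚ√5-ring
  cancel : ∀ l x → (l ⊕ neg x) ⊕ x ≡ l
  cancel = solve-∀ ℚ√5-ring
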